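{- Let $k\ge 3$ and let $G=(V,E)$ be a graph with linear arboricity at most $k$. Then there is an injective map $\phi:V\to\mathbb{R}^k$ and a decomposition of $E$ into $k$ sets, one assigned to each of the $k$ planes $P_{1,2},P_{1,3},\dots,P_{1,k}$ and $P_{2,3}$, such that for each of these planes the projection of $\phi$ onto it is injective on $V$ and, with edges drawn as straight-line segments between projected endpoints, gives a straight-line planar embedding of the corresponding edge set. In particular, $\mathrm{pdim}(G)\le k$.
   Context: A linear forest is a forest in which every component is a path; the linear arboricity of $G$ is the minimum number of linear forests into which $E$ can be partitioned. For $1\le a<b\le k$, $P_{a,b}=\{x\in\mathbb{R}^k: x_j=0 \text{ for all } j\notin\{a,b\}\}$ is the plane spanned by the $a$-th and $b$-th coordinate axes, and projection onto it maps $x\mapsto(x_a,x_b)$. Given a graph $G=(V,E)$, an injective map $\pi:V\to\mathbb{R}^d$ is a plane-projecting map if there is a decomposition $E=\bigcup_{1\le a<b\le d}E_{a,b}$ such that for every $a<b$, projection onto $P_{a,b}$ is injective on $V$ and gives a straight-line planar embedding of $(V,E_{a,b})$; $\mathrm{pdim}(G)$ is the smallest $d$ for which such a map into $\mathbb{R}^d$ exists. -}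

module Defs where

open import Data.Nat using (ℕ; _≤_)
open import Data.Fin using (Fin; zero; suc) renaming (_<_ to _<ᶠ_)
open import Data.Bool using (Bool; true; false)
open import Data.Rational using (ℚ; 0ℚ; 1ℚ; _+_; _*_; _-_) renaming (_≤_ to _≤ℚ_)
open import Data.Product using (Σ; ∃; ∃-syntax; _×_; _,_; proj₁; proj₂)
open import Data.Sum using (_⊎_)
open import Data.List using (List; []; _∷_; concat)
open import Data.List.Relation.Unary.Any using (Any)
open import Data.List.Relation.Unary.Unique.Propositional using (Unique)
open import Relation.Binary.PropositionalEquality using (_≡_; _≢_)
open import Relation.Nullary using (¬_)

record Graph (n : ℕ) : Set where
  field
    adj    : Fin n → Fin n → Bool
    sym    : ∀ u v → adj u v ≡ adj v u
    irrefl : ∀ u → adj u u ≡ false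
open Graph public

Edge : ∀ {n} → Graph n → Fin n → Fin n → Set
Edge G u v = adj G u v ≡ true

data Consec {n : ℕ} (u v : Fin n) : List (Fin n) → Set where
  here  : ∀ {xs} → Consec u v (u ∷ v ∷ xs)
  there : ∀ {x xs} → Consec u v xs → Consec u v (x ∷ xs)

-- A (spanning) subgraph H of the vertex set Fin n is a linear forest iff it
-- is a disjoint union of paths: there are vertex-disjoint paths (lists of
-- pairwise distinct vertices) whose edges are exactly the edges of H.
-- (Vertices on no listed path are trivial one-vertex components.)
IsLinearForest : ∀ {n} → (Fin n → Fin n → Set) → Set
IsLinearForest {n} H =
  Σ (List (List (Fin n))) λ paths →
    Unique (concat paths) ×
    (∀ u v → (H u v → Any (λ p → Consec u v p ⊎ Consec v u p) paths) ×
             (Any (λ p → Consec u v p ⊎ Consec v u p) paths → H u v))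

LinArbLe : ∀ {n} → Graph n → ℕ → Set
LinArbLe {n} G k =
  Σ (Fin n → Fin n → Fin k) λ col →
    (∀ u v → Edge G u v → col u v ≡ col v u) ×
    (∀ c → IsLinearForest (λ u v → Edge G u v × col u v ≡ c))

Point : Set
Point = ℚ × ℚ

OnSeg : Point → Point → Point → Set
OnSeg x p q =
  ∃[ t ] (0ℚ ≤ℚ t) × (t ≤ℚ 1ℚ) ×
    (x ≡ (proj₁ p + t * (proj₁ q - proj₁ p) , proj₂ p + t * (proj₂ q - proj₂ p)))

StraightLineEmbedding : ∀ {n} → (Fin n → Point) → (Fin n → Fin n → Set) → Set
StraightLineEmbedding {n} pos H =
  (∀ u v → pos u ≡ pos v → u ≡ v) ×
  (∀ u v w → H u v → w ≢ u → w ≢ v → ¬ OnSeg (pos w) (pos u) (pos v)) ×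
  (∀ u v w z → H u v → H w z →
     ¬ ((u ≡ w × v ≡ z) ⊎ (u ≡ z × v ≡ w)) →
     ∀ x → OnSeg x (pos u) (pos v) → OnSeg x (pos w) (pos z) →
     ∃[ y ] (y ≡ u ⊎ y ≡ v) × (y ≡ w ⊎ y ≡ z) × (x ≡ pos y))

proj : ∀ {d} → (Fin d → ℚ) → Fin d → Fin d → Point
proj x a b = (x a , x b)

-- The k planes P_{1,2}, P_{1,3}, …, P_{1,k}, P_{2,3} in ℚ^k, k = 3 + m.
-- Coordinates are 0-indexed: coordinate j of Fin k is the (j+1)-th axis.
-- Plane index zero ↦ P_{2,3};  plane index suc j ↦ P_{1,j+2}.

plane : (m : ℕ) → Fin (3 Data.Nat.+ m) → Fin (3 Data.Nat.+ m) × Fin (3 Data.Nat.+ m)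
plane m zero    = (suc zero , suc (suc zero))
plane m (suc j) = (zero , suc j)

PlaneProjecting : ∀ {n} → Graph n → ℕ → Set
PlaneProjecting {n} G d =
  Σ (Fin n → Fin d → ℚ) λ π →
    (∀ u v → (∀ i → π u i ≡ π v i) → u ≡ v) ×
    Σ (Fin n → Fin n → Fin d × Fin d) λ col →
      (∀ u v → Edge G u v → col u v ≡ col v u) ×
      (∀ u v → Edge G u v → proj₁ (col u v) <ᶠ proj₂ (col u v)) ×
      (∀ a b → a <ᶠ b →
         StraightLineEmbedding (λ v → proj (π v) a b)
                               (λ u v → Edge G u v × col u v ≡ (a , b)))

PdimLe : ∀ {n} → Graph n → ℕ → Set
PdimLe G k = ∃[ d ] (d ≤ k) × PlaneProjecting G d

-- Number the vertices of each linear forest along its paths, so that every edge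
-- of the forest joins two consecutively numbered vertices.  Give each of the k
-- planes its own forest and let that forest's numbering be one of the plane's two
-- axes, distinct axes for distinct planes: axis 2 for P₂₃, axis 1 for P₁₂ and
-- axis j for P₁ⱼ.  In such a plane every edge lies in the unit strip between its
-- endpoints' numbers, which contains no other vertex, and two strips share at most
-- a boundary line, which both edges meet only at their common endpoint.

{-# OPTIONS --safe #-}
module Submission where

open import Defs
open import Data.Nat using (ℕ; _+_)
open import Data.Fin using (Fin)
open import Data.Rational using (ℚ)
open import Data.Product using (Σ; _×_; _,_; proj₁; proj₂)
open import Relation.Binary.PropositionalEquality using (_≡_)

open import Algebra.Properties.Group using (∙-cancelˡ)
open import Data.Empty using (⊥; ⊥-elim)
open import Data.Fin using (zero; suc; _≟_) renaming (_<_ to _<ᶠ_)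
open import Data.Fin.Properties using (any?)
open import Data.List using (List; []; _∷_; _++_; concat; allFin)
open import Data.List.Membership.Propositional using (_∈_)
open import Data.List.Membership.Propositional.Properties using (∈-allFin; ∈-++⁺ʳ)
open import Data.List.Relation.Unary.All using (lookup; _∷_)
open import Data.List.Relation.Unary.AllPairs using (_∷_)
open import Data.List.Relation.Unary.Any using (Any; here; there)
open import Data.List.Relation.Unary.Any.Properties using (Any-⊎⁻)
open import Data.List.Relation.Unary.Unique.Propositional using (Unique)
open import Data.Nat as ℕ using (zero; suc; z≤n; s≤s)
import Data.Nat.Properties as ℕ
open import Data.Product using (∃-syntax)
import Data.Product.Properties as Product
open import Data.Rational as ℚ using (0ℚ; 1ℚ; _≤_; _<_; _*_; _-_; -_)
open import Data.Rational.Properties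
  using (≤-refl; ≤-reflexive; ≤-trans; ≤-antisym; <-trans; <⇒≤; <-irrefl; ≤-<-trans;
         +-monoʳ-≤; +-monoˡ-≤; +-monoʳ-<; +-identityʳ; +-inverseʳ; neg-antimono-≤;
         positive⁻¹; +-0-group)
open import Data.Rational.Solver using (module +-*-Solver)
open import Data.Sum using (_⊎_; inj₁; inj₂; [_,_]′)
import Data.Sum as Sum
open import Function.Definitions using (Injective)
open import Relation.Binary.Definitions using (tri<; tri≈; tri>)
open import Relation.Binary.PropositionalEquality
  using (_≢_; refl; trans; cong; cong₂; subst; subst₂; module ≡-Reasoning)
import Relation.Binary.PropositionalEquality as ≡
open import Relation.Nullary using (¬_; yes; no)

fromℕ : ℕ → ℚ
fromℕ zero    = 0ℚ
fromℕ (suc n) = fromℕ n ℚ.+ 1ℚ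

p<p+1 : ∀ p → p < p ℚ.+ 1ℚ
p<p+1 p = subst (_< p ℚ.+ 1ℚ) (+-identityʳ p) (+-monoʳ-< p (positive⁻¹ 1ℚ))

fromℕ-mono-< : ∀ {m n} → m ℕ.< n → fromℕ m < fromℕ n
fromℕ-mono-< {m} {suc n} (s≤s m≤n) with ℕ.m≤n⇒m<n∨m≡n m≤n
... | inj₁ m<n  = <-trans (fromℕ-mono-< m<n) (p<p+1 (fromℕ n))
... | inj₂ refl = p<p+1 (fromℕ m)

fromℕ-mono-≤ : ∀ {m n} → m ℕ.≤ n → fromℕ m ≤ fromℕ n
fromℕ-mono-≤ m≤n with ℕ.m≤n⇒m<n∨m≡n m≤n
... | inj₁ m<n  = <⇒≤ (fromℕ-mono-< m<n)
... | inj₂ refl = ≤-refl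

fromℕ-cancel-≤ : ∀ {m n} → fromℕ m ≤ fromℕ n → m ℕ.≤ n
fromℕ-cancel-≤ {m} {n} fm≤fn with ℕ.≤-<-connex m n
... | inj₁ m≤n = m≤n
... | inj₂ n<m = ⊥-elim (<-irrefl refl (≤-<-trans fm≤fn (fromℕ-mono-< n<m)))

fromℕ-injective : Injective _≡_ _≡_ fromℕ
fromℕ-injective eq =
  ℕ.≤-antisym (fromℕ-cancel-≤ (≤-reflexive eq)) (fromℕ-cancel-≤ (≤-reflexive (≡.sym eq)))

segPoint : Point → Point → ℚ → Point
segPoint p q t = ( proj₁ p ℚ.+ t * (proj₁ q - proj₁ p)
                 , proj₂ p ℚ.+ t * (proj₂ q - proj₂ p))

module _ where
  open +-*-Solver

  segPoint-0 : ∀ p q → segPoint p q 0ℚ ≡ p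
  segPoint-0 (p₁ , p₂) (q₁ , q₂) = cong₂ _,_ (start p₁ q₁) (start p₂ q₂)
    where
    start : ∀ a b → a ℚ.+ 0ℚ * (b - a) ≡ a
    start = solve 2 (λ a b → a :+ con 0ℚ :* (b :- a) := a) refl

  segPoint-1 : ∀ p q → segPoint p q 1ℚ ≡ q
  segPoint-1 (p₁ , p₂) (q₁ , q₂) = cong₂ _,_ (end p₁ q₁) (end p₂ q₂)
    where
    end : ∀ a b → a ℚ.+ 1ℚ * (b - a) ≡ b
    end = solve 2 (λ a b → a :+ con 1ℚ :* (b :- a) := b) refl

  segPoint-flip : ∀ p q t → segPoint p q t ≡ segPoint q p (1ℚ - t)
  segPoint-flip (p₁ , p₂) (q₁ , q₂) t = cong₂ _,_ (flip p₁ q₁ t) (flip p₂ q₂ t)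
    where
    flip : ∀ a b t → a ℚ.+ t * (b - a) ≡ b ℚ.+ (1ℚ - t) * (a - b)
    flip = solve 3 (λ a b t → a :+ t :* (b :- a) := b :+ (con 1ℚ :- t) :* (a :- b)) refl

  step-by-one : ∀ a t → a ℚ.+ t * ((a ℚ.+ 1ℚ) - a) ≡ a ℚ.+ t
  step-by-one = solve 2 (λ a t → a :+ t :* ((a :+ con 1ℚ) :- a) := a :+ t) refl

onSeg-sym : ∀ {x p q} → OnSeg x p q → OnSeg x q p
onSeg-sym {p = p} {q} (t , 0≤t , t≤1 , refl) =
  1ℚ - t , 0≤1-t , 1-t≤1 , segPoint-flip p q t
  where
  0≤1-t : 0ℚ ≤ 1ℚ - t
  0≤1-t = subst (_≤ 1ℚ - t) (+-inverseʳ t) (+-monoˡ-≤ (- t) t≤1)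
  1-t≤1 : 1ℚ - t ≤ 1ℚ
  1-t≤1 = subst (1ℚ - t ≤_) (+-identityʳ 1ℚ) (+-monoʳ-≤ 1ℚ (neg-antimono-≤ 0≤t))

AffineOnSegments : (Point → ℚ) → Set
AffineOnSegments κ = ∀ p q t → κ (segPoint p q t) ≡ κ p ℚ.+ t * (κ q - κ p)

proj₁-affine : AffineOnSegments proj₁
proj₁-affine p q t = refl

proj₂-affine : AffineOnSegments proj₂
proj₂-affine p q t = refl

-- Drawing edges between consecutively numbered vertices

SameEnds : ∀ {n} → Fin n → Fin n → Fin n → Fin n → Set
SameEnds u v w z = (u ≡ w × v ≡ z) ⊎ (u ≡ z × v ≡ w)

sameEnds-fst : ∀ {n} {a b u v : Fin n} → SameEnds a b u v → a ≡ u ⊎ a ≡ v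
sameEnds-fst (inj₁ (a≡u , _)) = inj₁ a≡u
sameEnds-fst (inj₂ (a≡v , _)) = inj₂ a≡v

sameEnds-snd : ∀ {n} {a b u v : Fin n} → SameEnds a b u v → b ≡ u ⊎ b ≡ v
sameEnds-snd (inj₁ (_ , b≡v)) = inj₂ b≡v
sameEnds-snd (inj₂ (_ , b≡u)) = inj₁ b≡u

sameEnds-euclidean : ∀ {n} {a b u v w z : Fin n} →
                     SameEnds a b u v → SameEnds a b w z → SameEnds u v w z
sameEnds-euclidean (inj₁ (refl , refl)) (inj₁ (refl , refl)) = inj₁ (refl , refl)
sameEnds-euclidean (inj₁ (refl , refl)) (inj₂ (refl , refl)) = inj₂ (refl , refl)
sameEnds-euclidean (inj₂ (refl , refl)) (inj₁ (refl , refl)) = inj₂ (refl , refl)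
sameEnds-euclidean (inj₂ (refl , refl)) (inj₂ (refl , refl)) = inj₁ (refl , refl)

Consecutive : ∀ {n} → (Fin n → ℕ) → Fin n → Fin n → Set
Consecutive ord u v = ord v ≡ suc (ord u) ⊎ ord u ≡ suc (ord v)

module StripEmbedding
  {n : ℕ} (pos : Fin n → Point) (κ : Point → ℚ) (κ-affine : AffineOnSegments κ)
  (ord : Fin n → ℕ) (ord-injective : Injective _≡_ _≡_ ord)
  (κ∘pos : ∀ v → κ (pos v) ≡ fromℕ (ord v))
  (H : Fin n → Fin n → Set) (H-consecutive : ∀ {u v} → H u v → Consecutive ord u v)
  where

  pos-injective : ∀ u v → pos u ≡ pos v → u ≡ v
  pos-injective u v eq =
    ord-injective (fromℕ-injective (trans (≡.sym (κ∘pos u)) (trans (cong κ eq) (κ∘pos v))))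

  record InStrip (x : Point) (a b : Fin n) : Set where
    field
      lower   : fromℕ (ord a) ≤ κ x
      upper   : κ x ≤ fromℕ (suc (ord a))
      atLower : κ x ≡ fromℕ (ord a) → x ≡ pos a
      atUpper : κ x ≡ fromℕ (suc (ord a)) → x ≡ pos b

  onSeg⇒inStrip : ∀ {x a b} → ord b ≡ suc (ord a) → OnSeg x (pos a) (pos b) → InStrip x a b
  onSeg⇒inStrip {a = a} {b} ord-b (t , 0≤t , t≤1 , refl) = record
    { lower   = ≤-trans A≤A+t (≤-reflexive (≡.sym κx≡A+t))
    ; upper   = ≤-trans (≤-reflexive κx≡A+t) (+-monoʳ-≤ A t≤1)
    ; atLower = λ κx≡A → endpoint 0ℚ (segPoint-0 (pos a) (pos b))
                                     (trans κx≡A (≡.sym (+-identityʳ A)))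
    ; atUpper = λ κx≡A+1 → endpoint 1ℚ (segPoint-1 (pos a) (pos b)) κx≡A+1
    }
    where
    open ≡-Reasoning
    A = fromℕ (ord a)
    A≤A+t : A ≤ A ℚ.+ t
    A≤A+t = subst (_≤ A ℚ.+ t) (+-identityʳ A) (+-monoʳ-≤ A 0≤t)
    κx≡A+t : κ (segPoint (pos a) (pos b) t) ≡ A ℚ.+ t
    κx≡A+t = begin
      κ (segPoint (pos a) (pos b) t)             ≡⟨ κ-affine (pos a) (pos b) t ⟩
      κ (pos a) ℚ.+ t * (κ (pos b) - κ (pos a))  ≡⟨ cong₂ (λ α β → α ℚ.+ t * (β - α)) (κ∘pos a)
                                                          (trans (κ∘pos b) (cong fromℕ ord-b)) ⟩
      A ℚ.+ t * ((A ℚ.+ 1ℚ) - A)                ≡⟨ step-by-one A t ⟩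
      A ℚ.+ t                                    ∎
    endpoint : ∀ {y} s → segPoint (pos a) (pos b) s ≡ y →
               κ (segPoint (pos a) (pos b) t) ≡ A ℚ.+ s → segPoint (pos a) (pos b) t ≡ y
    endpoint s eq κx≡A+s = trans (cong (segPoint (pos a) (pos b)) t≡s) eq
      where
      t≡s : t ≡ s
      t≡s = ∙-cancelˡ +-0-group A t s (trans (≡.sym κx≡A+t) κx≡A+s)

  record Oriented (x : Point) (u v : Fin n) : Set where
    field
      low high : Fin n
      succ     : ord high ≡ suc (ord low)
      ends     : SameEnds low high u v
      inStrip  : InStrip x low high
  open Oriented

  orient : ∀ {x u v} → H u v → OnSeg x (pos u) (pos v) → Oriented x u v
  orient {u = u} {v} h x∈uv with H-consecutive h
  ... | inj₁ ord-v = record { succ = ord-v ; ends = inj₁ (refl , refl)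
                            ; inStrip = onSeg⇒inStrip ord-v x∈uv }
  ... | inj₂ ord-u = record { succ = ord-u ; ends = inj₂ (refl , refl)
                            ; inStrip = onSeg⇒inStrip ord-u (onSeg-sym {p = pos u} {pos v} x∈uv) }

  strip-vertex : ∀ {w a b} → ord b ≡ suc (ord a) → InStrip (pos w) a b → w ≡ a ⊎ w ≡ b
  strip-vertex {w} {a} ord-b s =
    Sum.map (λ w<a+1 → ord-injective (ℕ.≤-antisym (ℕ.≤-pred w<a+1) a≤w))
            (λ w≡a+1 → ord-injective (trans w≡a+1 (≡.sym ord-b)))
            (ℕ.m≤n⇒m<n∨m≡n w≤a+1)
    where
    a≤w : ord a ℕ.≤ ord w
    a≤w = fromℕ-cancel-≤ (subst (_ ≤_) (κ∘pos w) (InStrip.lower s))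
    w≤a+1 : ord w ℕ.≤ suc (ord a)
    w≤a+1 = fromℕ-cancel-≤ (subst (_≤ _) (κ∘pos w) (InStrip.upper s))

  noVertex : ∀ u v w → H u v → w ≢ u → w ≢ v → ¬ OnSeg (pos w) (pos u) (pos v)
  noVertex u v w h w≢u w≢v w∈uv with orient h w∈uv
  ... | o with strip-vertex (succ o) (inStrip o)
  ...   | inj₁ refl = [ w≢u , w≢v ]′ (sameEnds-fst (ends o))
  ...   | inj₂ refl = [ w≢u , w≢v ]′ (sameEnds-snd (ends o))

  strips-meet : ∀ {x a b c d} → ord b ≡ suc (ord a) → InStrip x a b → InStrip x c d →
                ord a ℕ.< ord c → x ≡ pos b × b ≡ c
  strips-meet {x} {a} {b} {c} ord-b s₁ s₂ a<c =
    x≡b , pos-injective b c (trans (≡.sym x≡b) (InStrip.atLower s₂ κx≡c))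
    where
    a+1≤c : fromℕ (suc (ord a)) ≤ fromℕ (ord c)
    a+1≤c = fromℕ-mono-≤ a<c
    κx≡c : κ x ≡ fromℕ (ord c)
    κx≡c = ≤-antisym (≤-trans (InStrip.upper s₁) a+1≤c) (InStrip.lower s₂)
    x≡b : x ≡ pos b
    x≡b = InStrip.atUpper s₁ (≤-antisym (InStrip.upper s₁) (≤-trans a+1≤c (InStrip.lower s₂)))

  SharedEnd : Point → Fin n → Fin n → Fin n → Fin n → Set
  SharedEnd x u v w z = ∃[ y ] (y ≡ u ⊎ y ≡ v) × (y ≡ w ⊎ y ≡ z) × (x ≡ pos y)

  oriented-meet : ∀ {x u v w z} (e : Oriented x u v) (f : Oriented x w z) →
                  ord (low e) ℕ.< ord (low f) → SharedEnd x u v w z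
  oriented-meet e f a<c with strips-meet (succ e) (inStrip e) (inStrip f) a<c
  ... | x≡b , refl = high e , sameEnds-snd (ends e) , sameEnds-fst (ends f) , x≡b

  crossing : ∀ u v w z → H u v → H w z → ¬ SameEnds u v w z →
             ∀ x → OnSeg x (pos u) (pos v) → OnSeg x (pos w) (pos z) → SharedEnd x u v w z
  crossing u v w z huv hwz distinct x x∈uv x∈wz
    with orient huv x∈uv | orient hwz x∈wz
  ... | e | f with ℕ.<-cmp (ord (low e)) (ord (low f))
  ... | tri< a<c _ _ = oriented-meet e f a<c
  ... | tri> _ _ c<a = swap (oriented-meet f e c<a)
    where
    swap : SharedEnd x w z u v → SharedEnd x u v w z
    swap (y , y∈wz , y∈uv , x≡y) = y , y∈uv , y∈wz , x≡y
  ... | tri≈ _ a≡c _ =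
    ⊥-elim (distinct (sameEnds-euclidean (ends e)
                       (subst₂ (λ a b → SameEnds a b w z) low-f≡low-e high-f≡high-e (ends f))))
    where
    low-f≡low-e : low f ≡ low e
    low-f≡low-e = ord-injective (≡.sym a≡c)
    high-f≡high-e : high f ≡ high e
    high-f≡high-e = ord-injective (trans (succ f) (trans (cong suc (≡.sym a≡c)) (≡.sym (succ e))))

  straightLineEmbedding : StraightLineEmbedding pos H
  straightLineEmbedding = pos-injective , noVertex , crossing

-- Numbering the vertices of a linear forest along its paths

firstIndex : ∀ {n} → Fin n → List (Fin n) → ℕ
firstIndex v []       = zero
firstIndex v (x ∷ xs) with v ≟ x
... | yes _ = zero
... | no  _ = suc (firstIndex v xs)

firstIndex-head : ∀ {n} (v : Fin n) xs → firstIndex v (v ∷ xs) ≡ zero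
firstIndex-head v xs with v ≟ v
... | yes _   = refl
... | no  v≢v = ⊥-elim (v≢v refl)

firstIndex-tail : ∀ {n} {v x : Fin n} xs → v ≢ x → firstIndex v (x ∷ xs) ≡ suc (firstIndex v xs)
firstIndex-tail {v = v} {x} xs v≢x with v ≟ x
... | yes v≡x = ⊥-elim (v≢x v≡x)
... | no  _   = refl

firstIndex-injective : ∀ {n} {u v : Fin n} {xs} → u ∈ xs → firstIndex u xs ≡ firstIndex v xs → u ≡ v
firstIndex-injective {u = u} {v} {x ∷ xs} u∈ eq with u ≟ x | v ≟ x
firstIndex-injective _          _  | yes u≡x | yes v≡x = trans u≡x (≡.sym v≡x)
firstIndex-injective _          () | yes _   | no _
firstIndex-injective _          () | no _    | yes _
firstIndex-injective (here u≡x) _  | no u≢x  | no _    = ⊥-elim (u≢x u≡x)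
firstIndex-injective (there u∈) eq | no _    | no _    = firstIndex-injective u∈ (ℕ.suc-injective eq)

consec-∈ˡ : ∀ {n} {u v : Fin n} {xs} → Consec u v xs → u ∈ xs
consec-∈ˡ here      = here refl
consec-∈ˡ (there c) = there (consec-∈ˡ c)

consec-∈ʳ : ∀ {n} {u v : Fin n} {xs} → Consec u v xs → v ∈ xs
consec-∈ʳ here      = there (here refl)
consec-∈ʳ (there c) = there (consec-∈ʳ c)

consec-++ˡ : ∀ {n} {u v : Fin n} {xs} ys → Consec u v xs → Consec u v (xs ++ ys)
consec-++ˡ ys here      = here
consec-++ˡ ys (there c) = there (consec-++ˡ ys c)

consec-++ʳ : ∀ {n} {u v : Fin n} xs {ys} → Consec u v ys → Consec u v (xs ++ ys)
consec-++ʳ []       c = c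
consec-++ʳ (x ∷ xs) c = there (consec-++ʳ xs c)

consec-concat : ∀ {n} {u v : Fin n} xss → Any (Consec u v) xss → Consec u v (concat xss)
consec-concat (xs ∷ xss) (here c)  = consec-++ˡ (concat xss) c
consec-concat (xs ∷ xss) (there c) = consec-++ʳ xs (consec-concat xss c)

firstIndex-consec : ∀ {n} {u v : Fin n} {xs} ys → Unique xs → Consec u v xs →
                    firstIndex v (xs ++ ys) ≡ suc (firstIndex u (xs ++ ys))
firstIndex-consec {u = u} {v} {u ∷ v ∷ xs} ys ((u≢v ∷ _) ∷ _) here = begin
  firstIndex v (u ∷ v ∷ xs ++ ys)      ≡⟨ firstIndex-tail (v ∷ xs ++ ys) (λ v≡u → u≢v (≡.sym v≡u)) ⟩
  suc (firstIndex v (v ∷ xs ++ ys))    ≡⟨ cong suc (firstIndex-head v (xs ++ ys)) ⟩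
  suc zero                             ≡⟨ cong suc (firstIndex-head u (v ∷ xs ++ ys)) ⟨
  suc (firstIndex u (u ∷ v ∷ xs ++ ys)) ∎
  where open ≡-Reasoning
firstIndex-consec {u = u} {v} {x ∷ xs} ys (x∉xs ∷ unique) (there c) = begin
  firstIndex v (x ∷ xs ++ ys)          ≡⟨ firstIndex-tail (xs ++ ys) (≢x (consec-∈ʳ c)) ⟩
  suc (firstIndex v (xs ++ ys))        ≡⟨ cong suc (firstIndex-consec ys unique c) ⟩
  suc (suc (firstIndex u (xs ++ ys)))  ≡⟨ cong suc (firstIndex-tail (xs ++ ys) (≢x (consec-∈ˡ c))) ⟨
  suc (firstIndex u (x ∷ xs ++ ys))    ∎
  where
  open ≡-Reasoning
  ≢x : ∀ {y} → y ∈ xs → y ≢ x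
  ≢x y∈xs y≡x = lookup x∉xs y∈xs (≡.sym y≡x)

-- Vertices are numbered by their first position in the list of all paths one
-- after another, followed by all vertices (which numbers the vertices on no path).
linearForest-numbering : ∀ {n} {H : Fin n → Fin n → Set} → IsLinearForest H →
  Σ (Fin n → ℕ) λ ord → Injective _≡_ _≡_ ord × (∀ {u v} → H u v → Consecutive ord u v)
linearForest-numbering {n} {H} (paths , unique , edges) = ord , ord-injective , consecutive
  where
  vertices : List (Fin n)
  vertices = concat paths ++ allFin n

  ord : Fin n → ℕ
  ord v = firstIndex v vertices

  ord-injective : Injective _≡_ _≡_ ord
  ord-injective {u} = firstIndex-injective (∈-++⁺ʳ (concat paths) (∈-allFin u))

  consecutive : ∀ {u v} → H u v → Consecutive ord u v
  consecutive {u} {v} h =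
    Sum.map (λ c → firstIndex-consec (allFin n) unique (consec-concat paths c))
            (λ c → firstIndex-consec (allFin n) unique (consec-concat paths c))
            (Any-⊎⁻ (proj₁ (edges u v) h))

embedding-⊆ : ∀ {n} {pos : Fin n → Point} {H H′ : Fin n → Fin n → Set} →
              StraightLineEmbedding pos H → (∀ {u v} → H′ u v → H u v) →
              StraightLineEmbedding pos H′
embedding-⊆ (injective , noVertex , crossing) H′⊆H =
  injective ,
  (λ u v w h → noVertex u v w (H′⊆H h)) ,
  (λ u v w z h₁ h₂ → crossing u v w z (H′⊆H h₁) (H′⊆H h₂))

embedding-∅ : ∀ {n} {pos : Fin n → Point} → (∀ u v → pos u ≡ pos v → u ≡ v) →
              StraightLineEmbedding pos (λ _ _ → ⊥)
embedding-∅ injective = injective , (λ _ _ _ ()) , (λ _ _ _ _ ())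

EmbeddedInPlanes : ∀ {n d k} → Graph n → (Fin k → Fin d × Fin d) → (Fin n → Fin d → ℚ) → Set
EmbeddedInPlanes {n} {d} {k} G planes φ =
  Σ (Fin n → Fin n → Fin k) λ col →
    (∀ u v → Edge G u v → col u v ≡ col v u) ×
    (∀ i → StraightLineEmbedding
             (λ v → proj (φ v) (proj₁ (planes i)) (proj₂ (planes i)))
             (λ u v → Edge G u v × col u v ≡ i))

planeProjecting : ∀ {n d k} (G : Graph n) (planes : Fin k → Fin d × Fin d) →
  Injective _≡_ _≡_ planes → (∀ i → proj₁ (planes i) <ᶠ proj₂ (planes i)) →
  (φ : Fin n → Fin d → ℚ) → (∀ u v → (∀ i → φ u i ≡ φ v i) → u ≡ v) →
  (∀ a b → a <ᶠ b → ∀ u v → proj (φ u) a b ≡ proj (φ v) a b → u ≡ v) →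
  EmbeddedInPlanes G planes φ → PlaneProjecting G d
planeProjecting G planes planes-injective planes-ordered φ φ-injective proj-injective
                (col , col-sym , embedded) =
  φ , φ-injective , (λ u v → planes (col u v)) , (λ u v e → cong planes (col-sym u v e)) ,
  (λ u v _ → planes-ordered (col u v)) , embeddedIn
  where
  embeddedIn : ∀ a b → a <ᶠ b →
    StraightLineEmbedding (λ v → proj (φ v) a b) (λ u v → Edge G u v × planes (col u v) ≡ (a , b))
  embeddedIn a b a<b with any? (λ i → Product.≡-dec _≟_ _≟_ (planes i) (a , b))
  ... | yes (i , refl) = embedding-⊆ (embedded i) (λ (e , p) → e , planes-injective p)
  ... | no unused      = embedding-⊆ (embedding-∅ (proj-injective a b a<b)) (λ (_ , p) → unused (_ , p))

plane-injective : ∀ m → Injective _≡_ _≡_ (plane m)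
plane-injective m {zero}  {zero}  _  = refl
plane-injective m {suc i} {suc j} eq = cong proj₂ eq

plane-ordered : ∀ m i → proj₁ (plane m i) <ᶠ proj₂ (plane m i)
plane-ordered m zero    = s≤s (s≤s z≤n)
plane-ordered m (suc i) = s≤s z≤n

-- Coordinate σ i is an axis of plane i; it carries the numbering of the i-th forest.
σ : ∀ {m} → Fin (3 + m) → Fin (3 + m)
σ zero          = suc zero
σ (suc zero)    = zero
σ (suc (suc j)) = suc (suc j)

module PathCoordinates {m n} (G : Graph n) (col : Fin n → Fin n → Fin (3 + m))
  (col-sym : ∀ u v → Edge G u v → col u v ≡ col v u)
  (forest : ∀ c → IsLinearForest (λ u v → Edge G u v × col u v ≡ c))
  where

  numbering : ∀ c → Σ (Fin n → ℕ) λ ord → Injective _≡_ _≡_ ord ×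
                (∀ {u v} → Edge G u v × col u v ≡ c → Consecutive ord u v)
  numbering c = linearForest-numbering (forest c)

  ord : Fin (3 + m) → Fin n → ℕ
  ord c = proj₁ (numbering c)

  φ : Fin n → Fin (3 + m) → ℚ
  φ v j = fromℕ (ord (σ j) v)

  coordinate-injective : ∀ j {u v} → φ u j ≡ φ v j → u ≡ v
  coordinate-injective j eq = proj₁ (proj₂ (numbering (σ j))) (fromℕ-injective eq)

  φ-injective : ∀ u v → (∀ j → φ u j ≡ φ v j) → u ≡ v
  φ-injective u v eq = coordinate-injective zero (eq zero)

  proj-injective : ∀ a b u v → proj (φ u) a b ≡ proj (φ v) a b → u ≡ v
  proj-injective a b u v eq = coordinate-injective a (cong proj₁ eq)

  strip : ∀ c {pos} κ → AffineOnSegments κ → (∀ v → κ (pos v) ≡ fromℕ (ord c v)) →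
          StraightLineEmbedding pos (λ u v → Edge G u v × col u v ≡ c)
  strip c κ κ-affine κ∘pos =
    let (_ , ord-injective , consecutive) = numbering c in
    StripEmbedding.straightLineEmbedding _ κ κ-affine (ord c) ord-injective κ∘pos _ consecutive

  embedded : EmbeddedInPlanes G (plane m) φ
  embedded = col , col-sym , λ where
    zero          → strip zero proj₁ proj₁-affine (λ _ → refl)
    (suc zero)    → strip (suc zero) proj₁ proj₁-affine (λ _ → refl)
    (suc (suc j)) → strip (suc (suc j)) proj₂ proj₂-affine (λ _ → refl)

proposition1 : (m n : ℕ) (G : Graph n) → LinArbLe G (3 + m) →
    (Σ (Fin n → Fin (3 + m) → ℚ) λ φ →
      (∀ u v → (∀ i → φ u i ≡ φ v i) → u ≡ v) ×
      Σ (Fin n → Fin n → Fin (3 + m)) λ col →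
        (∀ u v → Edge G u v → col u v ≡ col v u) ×
        (∀ i → StraightLineEmbedding
                 (λ v → proj (φ v) (proj₁ (plane m i)) (proj₂ (plane m i)))
                 (λ u v → Edge G u v × col u v ≡ i)))
    × PdimLe G (3 + m)
proposition1 m n G (col , col-sym , forest) =
  (φ , φ-injective , embedded) ,
  (3 + m , ℕ.≤-refl ,
   planeProjecting G (plane m) (plane-injective m) (plane-ordered m) φ φ-injective
                   (λ a b _ → proj-injective a b) embedded)
  where open PathCoordinates G col col-sym forest
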